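{- Set $N=\lfloor n^{7/12}\rfloor$, let $X\sim\operatorname{HyperGeom}(n,N,N)$ and $Y\sim\mathrm{Binomial}(N^2,1/n)$. Then $$\max_{0\le k\le n^{1/5},\,k\in\mathbb{Z}}\left|\frac{\mathbb{P}(X=k)}{\mathbb{P}(Y=k)}-1\right|\to0\quad\text{as }n\to\infty.$$
   Context: $\operatorname{HyperGeom}(N',B,A)$ denotes the law of the number of red objects obtained when $B$ objects are drawn uniformly without replacement from $N'$ objects of which $A$ are red and $N'-A$ are blue. -}

module Defs where

open import Data.Nat using (ℕ; zero; suc; _∸_; _^_; _≤?_)
import Data.Nat as ℕ
open import Data.Nat.Combinatorics using (_C_)
open import Data.Integer using (+_)
open import Data.Rational using (ℚ; 0ℚ; _/_; _*_; _÷_; ≢-nonZero)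
open import Data.Rational.Properties using (_≟_)
open import Relation.Nullary using (yes; no)

-- a / d as a rational number (convention: 0 when d = 0; only used with d > 0)
divℕ : ℕ → ℕ → ℚ
divℕ a zero    = 0ℚ
divℕ a (suc d) = (+ a) / suc d

-- p / q in ℚ (convention: 0 when q = 0)
ratio : ℚ → ℚ → ℚ
ratio p q with q ≟ 0ℚ
... | yes _ = 0ℚ
... | no q≢0 = _÷_ p q {{≢-nonZero q≢0}}

-- P(X = k) for X ~ HyperGeom(N', B, A): B objects drawn without replacement
-- from N' objects of which A are red; X = number of red objects drawn.
hyperGeomPMF : ℕ → ℕ → ℕ → ℕ → ℚ
hyperGeomPMF N' B A k with k ≤? B
... | yes _ = divℕ ((A C k) ℕ.* ((N' ∸ A) C (B ∸ k))) (N' C B)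
... | no _  = 0ℚ

-- P(Y = k) for Y ~ Binomial(m, 1/n):  C(m,k) (1/n)^k (1 - 1/n)^(m-k)
--   = C(m,k) (n-1)^(m-k) / n^m   (for k ≤ m; C(m,k) = 0 for k > m)
binomialInvPMF : ℕ → ℕ → ℕ → ℚ
binomialInvPMF m n k = divℕ ((m C k) ℕ.* ((n ∸ 1) ^ (m ∸ k))) (n ^ m)

-- Clearing factorials, P(X = k) / P(Y = k) = A / B with
--   A = (N)ₖ² · (n − N)_{N−k} · n^{N²}  and  B = (N²)ₖ · (n − 1)^{N²−k} · (n)_N,
-- where (x)ᵣ = x P′ r is the falling factorial.  Comparing falling factorials
-- with powers factor by factor, and Bernoulli's inequality in both directions, give
--   A (1 − 2Nk/n) ≤ B  and  (1 − 2k²/N − 2N³/((n − N)(n − 1))) B ≤ A.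
-- For N ≈ n^{7/12} and k ≤ n^{1/5} each error term is O(n^{−11/60}), so
-- |A/B − 1| ≤ 1/M as soon as n ≥ (16 (M + 1))²⁰.
module Submission where

open import Defs
open import Data.Nat using (ℕ; suc; _^_; _≤_; _<_)
import Data.Nat as ℕ
open import Data.Rational using (ℚ; 0ℚ; 1ℚ; ∣_∣; _-_)
import Data.Rational as ℚ
open import Data.Product using (∃)

open import Data.Nat using (zero; z≤n; s≤s; _+_; _*_; _∸_; _!; _≤?_; NonZero; >-nonZero)
open import Data.Nat.Properties
open import Data.Nat.Combinatorics using (_C_; _P_; nCk≡nPk/k!)
open import Data.Nat.Combinatorics.Base using (_P′_)
open import Data.Nat.Combinatorics.Specification using (nP′n≡n!; nPk≡n!/[n∸k]!; nP′k≡n!/[n∸k]!; k!∣nP′k)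
open import Data.Nat.DivMod using (_/_; m/n*n≡m)
open import Data.Nat.Tactic.RingSolver using (solve-∀)
open import Data.Integer as ℤ using (-[1+_]; +[1+_]; _⊖_)
import Data.Integer.Properties as ℤ
open import Data.Rational using (mkℚ; toℚᵘ)
import Data.Rational.Properties as ℚ
open import Data.Rational.Unnormalised as ℚᵘ using (mkℚᵘ; *≡*; *≤*)
import Data.Rational.Unnormalised.Properties as ℚᵘ
open import Data.Product using (_,_)
open import Data.Sum using (inj₁; inj₂)
open import Relation.Binary.PropositionalEquality
open import Relation.Nullary using (yes; no; contradiction)
open import Algebra.Properties.CommutativeSemigroup *-commutativeSemigroup
  using (interchange; x∙yz≈y∙xz; x∙yz≈yx∙z; xy∙z≈xz∙y; xy∙z≈x∙zy; xy∙z≈y∙xz)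

-- Falling factorials

∏ : ℕ → (ℕ → ℕ) → ℕ
∏ zero    f = 1
∏ (suc r) f = f r * ∏ r f

∏-const : ∀ r c → ∏ r (λ _ → c) ≡ c ^ r
∏-const zero    c = refl
∏-const (suc r) c = cong (c *_) (∏-const r c)

∏-distrib-* : ∀ r f g → ∏ r (λ i → f i * g i) ≡ ∏ r f * ∏ r g
∏-distrib-* zero    f g = refl
∏-distrib-* (suc r) f g =
  trans (cong (f r * g r *_) (∏-distrib-* r f g)) (interchange (f r) (g r) (∏ r f) (∏ r g))

∏-mono-≤ : ∀ r {f g} → (∀ i → i < r → f i ≤ g i) → ∏ r f ≤ ∏ r g
∏-mono-≤ zero    f≤g = ≤-refl
∏-mono-≤ (suc r) f≤g = *-mono-≤ (f≤g r ≤-refl) (∏-mono-≤ r (λ i i<r → f≤g i (m<n⇒m<1+n i<r)))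

∏²-mono-≤ : ∀ r {f g h k} → (∀ i → i < r → f i * g i ≤ h i * k i) → ∏ r f * ∏ r g ≤ ∏ r h * ∏ r k
∏²-mono-≤ r {f} {g} {h} {k} fg≤hk = subst₂ _≤_ (∏-distrib-* r f g) (∏-distrib-* r h k) (∏-mono-≤ r fg≤hk)

nP′r≡∏ : ∀ n r → n P′ r ≡ ∏ r (n ∸_)
nP′r≡∏ n zero    = refl
nP′r≡∏ n (suc r) = cong ((n ∸ r) *_) (nP′r≡∏ n r)

nP′[r+s]≡nP′r*[n∸r]P′s : ∀ n r s → n P′ (r + s) ≡ (n P′ r) * ((n ∸ r) P′ s)
nP′[r+s]≡nP′r*[n∸r]P′s n r zero    = trans (cong (n P′_) (+-identityʳ r)) (sym (*-identityʳ (n P′ r)))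
nP′[r+s]≡nP′r*[n∸r]P′s n r (suc s) = begin
  n P′ (r + suc s)                          ≡⟨ cong (n P′_) (+-suc r s) ⟩
  (n ∸ (r + s)) * (n P′ (r + s))            ≡⟨ cong₂ _*_ (sym (∸-+-assoc n r s)) (nP′[r+s]≡nP′r*[n∸r]P′s n r s) ⟩
  (n ∸ r ∸ s) * ((n P′ r) * ((n ∸ r) P′ s)) ≡⟨ x∙yz≈y∙xz (n ∸ r ∸ s) (n P′ r) _ ⟩
  (n P′ r) * ((n ∸ r) P′ suc s)             ∎
  where open ≡-Reasoning

nP′r>0 : ∀ {n r} → r ≤ n → 0 < n P′ r
nP′r>0 {r = zero}  _   = s≤s z≤n
nP′r>0 {r = suc r} r<n = *-mono-< (m<n⇒0<n∸m r<n) (nP′r>0 (<⇒≤ r<n))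

nCk*k!≡nP′k : ∀ {n k} → k ≤ n → (n C k) * k ! ≡ n P′ k
nCk*k!≡nP′k {n} {k} k≤n = begin
  (n C k) * k !          ≡⟨ cong (_* k !) (nCk≡nPk/k! k≤n) ⟩
  ((n P k) / k !) * k !  ≡⟨ cong (λ x → (x / k !) * k !) (trans (nPk≡n!/[n∸k]! k≤n) (sym (nP′k≡n!/[n∸k]! k≤n))) ⟩
  ((n P′ k) / k !) * k ! ≡⟨ m/n*n≡m (k!∣nP′k k≤n) ⟩
  n P′ k                 ∎
  where
  open ≡-Reasoning
  instance _ = k !≢0

nCk>0 : ∀ {n k} → k ≤ n → 0 < n C k
nCk>0 {n} {k} k≤n = n≢0⇒n>0 λ nCk≡0 →
  n>0⇒n≢0 (nP′r>0 k≤n) (trans (sym (nCk*k!≡nP′k k≤n)) (cong (_* k !) nCk≡0))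

m+n≤o∧i<n⇒m≤o∸i : ∀ {m n o i} → m + n ≤ o → i < n → m ≤ o ∸ i
m+n≤o∧i<n⇒m≤o∸i {m} {i = i} m+n≤o i<n =
  ≤-trans (≤-reflexive (sym (m+n∸n≡m m i))) (∸-monoˡ-≤ i (≤-trans (+-monoʳ-≤ m (<⇒≤ i<n)) m+n≤o))

nP′r≤n^r : ∀ n r → n P′ r ≤ n ^ r
nP′r≤n^r n r rewrite nP′r≡∏ n r | sym (∏-const r n) = ∏-mono-≤ r (λ i _ → m∸n≤m n i)

c+r≤n⇒c^r≤nP′r : ∀ {c n} r → c + r ≤ n → c ^ r ≤ n P′ r
c+r≤n⇒c^r≤nP′r {c} {n} r c+r≤n rewrite nP′r≡∏ n r | sym (∏-const r c) =
  ∏-mono-≤ r (λ i → m+n≤o∧i<n⇒m≤o∸i c+r≤n)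

aP′r*n^r≤a^r*nP′r : ∀ {a n} r → a ≤ n → (a P′ r) * n ^ r ≤ a ^ r * (n P′ r)
aP′r*n^r≤a^r*nP′r {a} {n} r a≤n
  rewrite nP′r≡∏ a r | nP′r≡∏ n r | sym (∏-const r a) | sym (∏-const r n) = ∏²-mono-≤ r λ i _ → begin
    (a ∸ i) * n   ≡⟨ *-distribʳ-∸ n a i ⟩
    a * n ∸ i * n ≤⟨ ∸-monoʳ-≤ (a * n) (≤-trans (≤-reflexive (*-comm a i)) (*-monoʳ-≤ i a≤n)) ⟩
    a * n ∸ a * i ≡⟨ *-distribˡ-∸ a n i ⟨
    a * (n ∸ i)   ∎
  where open ≤-Reasoning

[n∸i]²+i≤n² : ∀ {n i} → i ≤ n → (n ∸ i) * (n ∸ i) + i ≤ n * n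
[n∸i]²+i≤n² {i = i} i≤n with m≤n⇒∃[o]m+o≡n i≤n
... | o , refl = begin
  (i + o ∸ i) * (i + o ∸ i) + i ≡⟨ cong (λ x → x * x + i) (m+n∸m≡n i o) ⟩
  o * o + i                     ≤⟨ +-monoʳ-≤ (o * o) (i≤i*[i+o+o] i) ⟩
  o * o + i * (i + o + o)       ≡⟨ expand i o ⟨
  (i + o) * (i + o)             ∎
  where
  open ≤-Reasoning
  i≤i*[i+o+o] : ∀ i → i ≤ i * (i + o + o)
  i≤i*[i+o+o] zero    = z≤n
  i≤i*[i+o+o] (suc i) = m≤m*n (suc i) (suc i + o + o)
  expand : ∀ i o → (i + o) * (i + o) ≡ o * o + i * (i + o + o)
  expand = solve-∀

[nP′r]²≤[n*n]P′r : ∀ {n} r → r ≤ n → (n P′ r) * (n P′ r) ≤ (n * n) P′ r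
[nP′r]²≤[n*n]P′r {n} r r≤n rewrite nP′r≡∏ n r | nP′r≡∏ (n * n) r = begin
  ∏ r (n ∸_) * ∏ r (n ∸_)        ≤⟨ ∏²-mono-≤ r (λ i i<r → factor (≤-trans (<⇒≤ i<r) r≤n)) ⟩
  ∏ r (n * n ∸_) * ∏ r (λ _ → 1) ≡⟨ cong (∏ r (n * n ∸_) *_) (trans (∏-const r 1) (^-zeroˡ r)) ⟩
  ∏ r (n * n ∸_) * 1             ≡⟨ *-identityʳ _ ⟩
  ∏ r (n * n ∸_)                 ∎
  where
  open ≤-Reasoning
  factor : ∀ {i} → i ≤ n → (n ∸ i) * (n ∸ i) ≤ (n * n ∸ i) * 1
  factor i≤n = ≤-trans (m+n≤o⇒m≤o∸n _ ([n∸i]²+i≤n² i≤n)) (≤-reflexive (sym (*-identityʳ _)))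

[n*n]P′r*[c*c]^r≤[nP′r]²*[n*n]^r : ∀ {c n} r → c + r ≤ n →
  ((n * n) P′ r) * (c * c) ^ r ≤ ((n P′ r) * (n P′ r)) * (n * n) ^ r
[n*n]P′r*[c*c]^r≤[nP′r]²*[n*n]^r {c} {n} r c+r≤n
  rewrite nP′r≡∏ n r | nP′r≡∏ (n * n) r | sym (∏-const r (c * c)) | sym (∏-const r (n * n))
        | sym (∏-distrib-* r (n ∸_) (n ∸_)) = ∏²-mono-≤ r λ i i<r →
  let c≤n∸i : c ≤ n ∸ i
      c≤n∸i = m+n≤o∧i<n⇒m≤o∸i c+r≤n i<r
  in ≤-trans (*-mono-≤ (m∸n≤m (n * n) i) (*-mono-≤ c≤n∸i c≤n∸i)) (≤-reflexive (*-comm (n * n) _))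

[a+n]P′r*[a∸n]^r≤aP′r*a^r : ∀ {a n} r → r ≤ n → n ≤ a → ((a + n) P′ r) * (a ∸ n) ^ r ≤ (a P′ r) * a ^ r
[a+n]P′r*[a∸n]^r≤aP′r*a^r {a} {n} r r≤n n≤a
  rewrite nP′r≡∏ (a + n) r | nP′r≡∏ a r | sym (∏-const r (a ∸ n)) | sym (∏-const r a) =
  ∏²-mono-≤ r λ i i<r → factor (≤-trans (<⇒≤ i<r) r≤n) n≤a
  where
  -- writing n = i + e and a = n + c, the two sides differ by n (n − i) = (i + e) e
  factor : ∀ {a n i} → i ≤ n → n ≤ a → (a + n ∸ i) * (a ∸ n) ≤ (a ∸ i) * a
  factor {i = i} i≤n n≤a with m≤n⇒∃[o]m+o≡n i≤n | m≤n⇒∃[o]m+o≡n n≤a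
  ... | e , refl | c , refl = begin
    (i + e + c + (i + e) ∸ i) * (i + e + c ∸ (i + e))
      ≡⟨ cong₂ _*_ (trans (cong (_∸ i) (shift i e c)) (m+n∸m≡n i _)) (m+n∸m≡n (i + e) c) ⟩
    (e + c + (i + e)) * c
      ≤⟨ m≤m+n _ _ ⟩
    (e + c + (i + e)) * c + (i + e) * e
      ≡⟨ expand i e c ⟩
    (e + c) * (i + e + c)
      ≡⟨ cong (_* (i + e + c)) (trans (cong (_∸ i) (+-assoc i e c)) (m+n∸m≡n i (e + c))) ⟨
    (i + e + c ∸ i) * (i + e + c) ∎
    where
    open ≤-Reasoning
    shift : ∀ i e c → i + e + c + (i + e) ≡ i + (e + c + (i + e))
    shift = solve-∀
    expand : ∀ i e c → (e + c + (i + e)) * c + (i + e) * e ≡ (e + c) * (i + e + c)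
    expand = solve-∀

-- Relative lower bounds

infix 4 _≳⟨_/_⟩_

-- x ≳⟨ α / D ⟩ X  says  x ≥ (1 − α / D) X,  with the division cleared.
record _≳⟨_/_⟩_ (x α D X : ℕ) : Set where
  constructor mk≳
  field bound : X * D ≤ x * D + α * X

≳-self : ∀ {x α X} → X ≤ x + α → x ≳⟨ α / X ⟩ X
≳-self {x} {α} {X} X≤x+α = mk≳ (≤-trans (*-monoˡ-≤ X X≤x+α) (≤-reflexive (*-distribʳ-+ X x α)))

≳-∸ : ∀ {n d} → d ≤ n → n ∸ d ≳⟨ d / n ⟩ n
≳-∸ d≤n = ≳-self (≤-reflexive (sym (m∸n+n≡m d≤n)))

≳-weaken : ∀ {x X α β D} → α ≤ β → x ≳⟨ α / D ⟩ X → x ≳⟨ β / D ⟩ X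
≳-weaken {x} {X} {D = D} α≤β (mk≳ h) = mk≳ (≤-trans h (+-monoʳ-≤ (x * D) (*-monoˡ-≤ X α≤β)))

≳-scale : ∀ {x X α D} E → x ≳⟨ α / D ⟩ X → x ≳⟨ α * E / D * E ⟩ X
≳-scale {x} {X} {α} {D} E (mk≳ h) = mk≳ (begin
  X * (D * E)             ≡⟨ *-assoc X D E ⟨
  X * D * E               ≤⟨ *-monoˡ-≤ E h ⟩
  (x * D + α * X) * E     ≡⟨ distribute x D α X E ⟩
  x * (D * E) + α * E * X ∎)
  where
  open ≤-Reasoning
  distribute : ∀ x D α X E → (x * D + α * X) * E ≡ x * (D * E) + α * E * X
  distribute = solve-∀

≳-* : ∀ {x X α y Y β D} → x ≤ X → x ≳⟨ α / D ⟩ X → y ≳⟨ β / D ⟩ Y → x * y ≳⟨ α + β / D ⟩ X * Y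
≳-* {x} {X} {α} {y} {Y} {β} {D} x≤X (mk≳ hx) (mk≳ hy) = mk≳ (begin
  X * Y * D                             ≡⟨ xy∙z≈y∙xz X Y D ⟩
  Y * (X * D)                           ≤⟨ *-monoʳ-≤ Y hx ⟩
  Y * (x * D + α * X)                   ≡⟨ distribute₁ x X Y D α ⟩
  x * (Y * D) + α * (X * Y)             ≤⟨ +-monoˡ-≤ _ (*-monoʳ-≤ x hy) ⟩
  x * (y * D + β * Y) + α * (X * Y)     ≡⟨ distribute₂ x y Y D β α X ⟩
  x * y * D + β * (x * Y) + α * (X * Y) ≤⟨ +-monoˡ-≤ _ (+-monoʳ-≤ (x * y * D) (*-monoʳ-≤ β (*-monoˡ-≤ Y x≤X))) ⟩
  x * y * D + β * (X * Y) + α * (X * Y) ≡⟨ collect (x * y * D) β α (X * Y) ⟩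
  x * y * D + (α + β) * (X * Y)         ∎)
  where
  open ≤-Reasoning
  distribute₁ : ∀ x X Y D α → Y * (x * D + α * X) ≡ x * (Y * D) + α * (X * Y)
  distribute₁ = solve-∀
  distribute₂ : ∀ x y Y D β α X → x * (y * D + β * Y) + α * (X * Y) ≡ x * y * D + β * (x * Y) + α * (X * Y)
  distribute₂ = solve-∀
  collect : ∀ z β α W → z + β * W + α * W ≡ z + (α + β) * W
  collect = solve-∀

≳-^ : ∀ {x X α D} → x ≤ X → x ≳⟨ α / D ⟩ X → ∀ r → x ^ r ≳⟨ r * α / D ⟩ X ^ r
≳-^ x≤X x≳X zero    = mk≳ (≤-reflexive (sym (+-identityʳ _)))
≳-^ x≤X x≳X (suc r) = ≳-* x≤X x≳X (≳-^ x≤X x≳X r)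

≳-transfer : ∀ {x X z Z α D} → 0 < Z → X * z ≤ x * Z → z ≳⟨ α / D ⟩ Z → x ≳⟨ α / D ⟩ X
≳-transfer {x} {X} {z} {Z} {α} {D} Z>0 Xz≤xZ (mk≳ h) =
  mk≳ (*-cancelʳ-≤ (X * D) (x * D + α * X) Z {{>-nonZero Z>0}} (begin
    X * D * Z             ≡⟨ xy∙z≈x∙zy X D Z ⟩
    X * (Z * D)           ≤⟨ *-monoʳ-≤ X h ⟩
    X * (z * D + α * Z)   ≡⟨ distribute X z D α Z ⟩
    X * z * D + α * X * Z ≤⟨ +-monoˡ-≤ _ (*-monoˡ-≤ D Xz≤xZ) ⟩
    x * Z * D + α * X * Z ≡⟨ collect x Z D α X ⟩
    (x * D + α * X) * Z   ∎))
  where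
  open ≤-Reasoning
  distribute : ∀ X z D α Z → X * (z * D + α * Z) ≡ X * z * D + α * X * Z
  distribute = solve-∀
  collect : ∀ x Z D α X → x * Z * D + α * X * Z ≡ (x * D + α * X) * Z
  collect = solve-∀

≳⇒[D∸α]*X≤x*D : ∀ {x X α D} → x ≳⟨ α / D ⟩ X → (D ∸ α) * X ≤ x * D
≳⇒[D∸α]*X≤x*D {x} {X} {α} {D} (mk≳ h) = begin
  (D ∸ α) * X           ≡⟨ *-distribʳ-∸ X D α ⟩
  D * X ∸ α * X         ≡⟨ cong (_∸ α * X) (*-comm D X) ⟩
  X * D ∸ α * X         ≤⟨ ∸-monoˡ-≤ (α * X) h ⟩
  x * D + α * X ∸ α * X ≡⟨ m+n∸n≡m (x * D) (α * X) ⟩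
  x * D                 ∎
  where open ≤-Reasoning

≳⇒M*X≤[1+M]*x : ∀ {x X α D} M → 0 < D → suc M * α ≤ D → x ≳⟨ α / D ⟩ X → M * X ≤ suc M * x
≳⇒M*X≤[1+M]*x {x} {X} {α} {D} M D>0 [1+M]α≤D (mk≳ h) = *-cancelʳ-≤ (M * X) (suc M * x) D {{>-nonZero D>0}}
  (+-cancelʳ-≤ (X * D) (M * X * D) (suc M * x * D) (begin
    M * X * D + X * D               ≡⟨ collect M X D ⟩
    suc M * (X * D)                 ≤⟨ *-monoʳ-≤ (suc M) h ⟩
    suc M * (x * D + α * X)         ≡⟨ distribute M x D α X ⟩
    suc M * x * D + (suc M * α) * X ≤⟨ +-monoʳ-≤ (suc M * x * D) (*-monoˡ-≤ X [1+M]α≤D) ⟩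
    suc M * x * D + D * X           ≡⟨ cong (suc M * x * D +_) (*-comm D X) ⟩
    suc M * x * D + X * D           ∎))
  where
  open ≤-Reasoning
  collect : ∀ M X D → M * X * D + X * D ≡ suc M * (X * D)
  collect = solve-∀
  distribute : ∀ M x D α X → suc M * (x * D + α * X) ≡ suc M * x * D + (suc M * α) * X
  distribute = solve-∀

≳⇒M*X≤M*x+X : ∀ {x X α D} M → 0 < D → M * α ≤ D → x ≳⟨ α / D ⟩ X → M * X ≤ M * x + X
≳⇒M*X≤M*x+X {x} {X} {α} {D} M D>0 Mα≤D (mk≳ h) = *-cancelʳ-≤ (M * X) (M * x + X) D {{>-nonZero D>0}} (begin
  M * X * D             ≡⟨ *-assoc M X D ⟩
  M * (X * D)           ≤⟨ *-monoʳ-≤ M h ⟩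
  M * (x * D + α * X)   ≡⟨ distribute M x D α X ⟩
  M * x * D + M * α * X ≤⟨ +-monoʳ-≤ (M * x * D) (*-monoˡ-≤ X Mα≤D) ⟩
  M * x * D + D * X     ≡⟨ collect M x D X ⟩
  (M * x + X) * D       ∎)
  where
  open ≤-Reasoning
  distribute : ∀ M x D α X → M * (x * D + α * X) ≡ M * x * D + M * α * X
  distribute = solve-∀
  collect : ∀ M x D X → M * x * D + D * X ≡ (M * x + X) * D
  collect = solve-∀

-- Powers and Bernoulli's inequality

[m*n]^o≡m^o*n^o : ∀ m n o → (m * n) ^ o ≡ m ^ o * n ^ o
[m*n]^o≡m^o*n^o m n zero    = refl
[m*n]^o≡m^o*n^o m n (suc o) = trans (cong (m * n *_) ([m*n]^o≡m^o*n^o m n o)) (interchange m n (m ^ o) (n ^ o))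

[x*y*z]^e≡x^e*y^e*z^e : ∀ x y z e → (x * y * z) ^ e ≡ x ^ e * y ^ e * z ^ e
[x*y*z]^e≡x^e*y^e*z^e x y z e = trans ([m*n]^o≡m^o*n^o (x * y) z e) (cong (_* z ^ e) ([m*n]^o≡m^o*n^o x y e))

^-cancelˡ-≤ : ∀ e .{{_ : NonZero e}} {x y} → x ^ e ≤ y ^ e → x ≤ y
^-cancelˡ-≤ e {x} {y} xᵉ≤yᵉ with x ≤? y
... | yes x≤y = x≤y
... | no x≰y  = contradiction xᵉ≤yᵉ (<⇒≱ (^-monoˡ-< e (≰⇒> x≰y)))

^-cancelˡ-< : ∀ e {x y} → x ^ e < y ^ e → x < y
^-cancelˡ-< e {x} {y} xᵉ<yᵉ with x <? y
... | yes x<y = x<y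
... | no x≮y  = contradiction (^-monoˡ-≤ e (≮⇒≥ x≮y)) (<⇒≱ xᵉ<yᵉ)

[n∸N]*n^N≤[n∸1]^N*n : ∀ {n} N → 1 ≤ n → (n ∸ N) * n ^ N ≤ (n ∸ 1) ^ N * n
[n∸N]*n^N≤[n∸1]^N*n {n} N 1≤n = subst (λ α → (n ∸ α) * n ^ N ≤ (n ∸ 1) ^ N * n) (*-identityʳ N)
  (≳⇒[D∸α]*X≤x*D (≳-^ (m∸n≤m n 1) (≳-∸ 1≤n) N))

b^N*[b+N]≤[1+b]^N*b : ∀ b N → b ^ N * (b + N) ≤ suc b ^ N * b
b^N*[b+N]≤[1+b]^N*b b zero    = ≤-reflexive (trans (*-identityˡ _) (trans (+-identityʳ b) (sym (*-identityˡ b))))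
b^N*[b+N]≤[1+b]^N*b b (suc N) = begin
  b * b ^ N * (b + suc N)                 ≡⟨ distribute b (b ^ N) N ⟩
  b * (b ^ N * (b + N)) + b * b ^ N       ≤⟨ +-monoʳ-≤ (b * (b ^ N * (b + N))) b*b^N≤b^N*[b+N] ⟩
  b * (b ^ N * (b + N)) + b ^ N * (b + N) ≡⟨ +-comm (b * (b ^ N * (b + N))) _ ⟩
  suc b * (b ^ N * (b + N))               ≤⟨ *-monoʳ-≤ (suc b) (b^N*[b+N]≤[1+b]^N*b b N) ⟩
  suc b * (suc b ^ N * b)                 ≡⟨ *-assoc (suc b) (suc b ^ N) b ⟨
  suc b * suc b ^ N * b                   ∎
  where
  open ≤-Reasoning
  b*b^N≤b^N*[b+N] : b * b ^ N ≤ b ^ N * (b + N)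
  b*b^N≤b^N*[b+N] = ≤-trans (≤-reflexive (*-comm b (b ^ N))) (*-monoʳ-≤ (b ^ N) (m≤m+n b N))
  distribute : ∀ b p N → b * p * (b + suc N) ≡ b * (p * (b + N)) + b * p
  distribute = solve-∀

-- Comparing the hypergeometric and binomial weights

[n∸N]P′r*n^[N*r]≤[n∸1]^[N*r]*nP′r : ∀ {n N} r → 1 ≤ n →
  ((n ∸ N) P′ r) * n ^ (N * r) ≤ (n ∸ 1) ^ (N * r) * (n P′ r)
[n∸N]P′r*n^[N*r]≤[n∸1]^[N*r]*nP′r {n} {N} r 1≤n = *-cancelʳ-≤ _ _ (n ^ r) {{m^n≢0 n r {{>-nonZero 1≤n}}}} (begin
  (a P′ r) * n ^ (N * r) * n ^ r         ≡⟨ xy∙z≈xz∙y (a P′ r) _ _ ⟩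
  (a P′ r) * n ^ r * n ^ (N * r)         ≤⟨ *-monoˡ-≤ _ (aP′r*n^r≤a^r*nP′r r (m∸n≤m n N)) ⟩
  a ^ r * (n P′ r) * n ^ (N * r)         ≡⟨ xy∙z≈y∙xz (a ^ r) _ _ ⟩
  (n P′ r) * (a ^ r * n ^ (N * r))       ≤⟨ *-monoʳ-≤ (n P′ r) a^r*n^[N*r]≤[n∸1]^[N*r]*n^r ⟩
  (n P′ r) * ((n ∸ 1) ^ (N * r) * n ^ r) ≡⟨ x∙yz≈yx∙z (n P′ r) ((n ∸ 1) ^ (N * r)) (n ^ r) ⟩
  (n ∸ 1) ^ (N * r) * (n P′ r) * n ^ r   ∎)
  where
  open ≤-Reasoning
  a : ℕ
  a = n ∸ N
  a^r*n^[N*r]≤[n∸1]^[N*r]*n^r : a ^ r * n ^ (N * r) ≤ (n ∸ 1) ^ (N * r) * n ^ r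
  a^r*n^[N*r]≤[n∸1]^[N*r]*n^r = subst₂ _≤_
    (trans ([m*n]^o≡m^o*n^o a (n ^ N) r) (cong (a ^ r *_) (^-*-assoc n N r)))
    (trans ([m*n]^o≡m^o*n^o ((n ∸ 1) ^ N) n r) (cong (_* n ^ r) (^-*-assoc (n ∸ 1) N r)))
    (^-monoˡ-≤ r ([n∸N]*n^N≤[n∸1]^N*n N 1≤n))

[NP′k]²≳[N*N]P′k : ∀ {N k} → 1 ≤ N → k ≤ N → (N P′ k) * (N P′ k) ≳⟨ k * (k + k) / N ⟩ (N * N) P′ k
[NP′k]²≳[N*N]P′k {N} {k} 1≤N k≤N = ≳-transfer (m^n>0 (N * N) {{>-nonZero (*-mono-< 1≤N 1≤N)}} k)
  ([n*n]P′r*[c*c]^r≤[nP′r]²*[n*n]^r k (≤-reflexive (m∸n+n≡m k≤N)))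
  (≳-^ (*-mono-≤ (m∸n≤m N k) (m∸n≤m N k)) (≳-* (m∸n≤m N k) (≳-∸ k≤N) (≳-∸ k≤N)) k)

[n∸2N]*[n∸1+N]+2N²≡[n∸N]*[n∸1]+N : ∀ {n N} → 1 ≤ N → N + N ≤ n →
  (n ∸ (N + N)) * ((n ∸ 1) + N) + (N * N + N * N) ≡ (n ∸ N) * (n ∸ 1) + N
[n∸2N]*[n∸1+N]+2N²≡[n∸N]*[n∸1]+N {N = N} 1≤N N+N≤n with m≤n⇒∃[o]m+o≡n N+N≤n | 1≤N
... | q , refl | s≤s {_} {N′} z≤n = begin
  (N + N + q ∸ (N + N)) * (N + N + q ∸ 1 + N) + (N * N + N * N)
    ≡⟨ cong (λ x → x * (N + N + q ∸ 1 + N) + (N * N + N * N)) (m+n∸m≡n (N + N) q) ⟩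
  q * (N′ + N + q + N) + (N * N + N * N)
    ≡⟨ expand N′ q ⟩
  (N + q) * (N′ + N + q) + N
    ≡⟨ cong (λ x → x * (N′ + N + q) + N) (trans (cong (_∸ N) (+-assoc N N q)) (m+n∸m≡n N (N + q))) ⟨
  (N + N + q ∸ N) * (N + N + q ∸ 1) + N ∎
  where
  open ≡-Reasoning
  expand : ∀ N′ q → q * (N′ + suc N′ + q + suc N′) + (suc N′ * suc N′ + suc N′ * suc N′)
                     ≡ (suc N′ + q) * (N′ + suc N′ + q) + suc N′
  expand = solve-∀

M*∣a-b∣≤b : ∀ M {a b} → M * a ≤ M * b + b → M * b ≤ M * a + b → M * ℕ.∣ a - b ∣ ≤ b
M*∣a-b∣≤b M {a} {b} Ma≤Mb+b Mb≤Ma+b with ∣m-n∣≡[m∸n]∨[n∸m] a b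
... | inj₁ ∣a-b∣≡a∸b rewrite ∣a-b∣≡a∸b | *-distribˡ-∸ M a b = m≤n+o⇒m∸n≤o (M * a) (M * b) Ma≤Mb+b
... | inj₂ ∣a-b∣≡b∸a rewrite ∣a-b∣≡b∸a | *-distribˡ-∸ M b a = m≤n+o⇒m∸n≤o (M * b) (M * a) Mb≤Ma+b

x*t≡y*s⇒M*∣x-y∣≤y : ∀ M {x y s t} → 0 < t → x * t ≡ y * s → M * ℕ.∣ s - t ∣ ≤ t → M * ℕ.∣ x - y ∣ ≤ y
x*t≡y*s⇒M*∣x-y∣≤y M {x} {y} {s} {t} t>0 xt≡ys M∣s-t∣≤t = *-cancelʳ-≤ _ _ t {{>-nonZero t>0}} (begin
  M * ℕ.∣ x - y ∣ * t     ≡⟨ *-assoc M _ t ⟩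
  M * (ℕ.∣ x - y ∣ * t)   ≡⟨ cong (M *_) (*-distribʳ-∣-∣ t x y) ⟩
  M * ℕ.∣ x * t - y * t ∣ ≡⟨ cong (λ z → M * ℕ.∣ z - y * t ∣) xt≡ys ⟩
  M * ℕ.∣ y * s - y * t ∣ ≡⟨ cong (M *_) (*-distribˡ-∣-∣ y s t) ⟨
  M * (y * ℕ.∣ s - t ∣)   ≡⟨ x∙yz≈y∙xz M y _ ⟩
  y * (M * ℕ.∣ s - t ∣)   ≤⟨ *-monoʳ-≤ y M∣s-t∣≤t ⟩
  y * t                   ∎)
  where open ≤-Reasoning

module HyperGeomVsBinomial {n N k : ℕ} (1≤N : 1 ≤ N) (k≤N : k ≤ N) (N+N≤n : N + N ≤ n) where

  m a r : ℕ
  m = N * N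
  a = n ∸ N
  r = N ∸ k

  N≤n : N ≤ n
  N≤n = ≤-trans (m≤m+n N N) N+N≤n

  N≤a : N ≤ a
  N≤a = subst (_≤ a) (m+n∸n≡m N N) (∸-monoˡ-≤ N N+N≤n)

  1≤a : 1 ≤ a
  1≤a = ≤-trans 1≤N N≤a

  1≤n : 1 ≤ n
  1≤n = ≤-trans 1≤N N≤n

  1≤n∸1 : 1 ≤ n ∸ 1
  1≤n∸1 = ∸-monoˡ-≤ 1 (≤-trans (+-mono-≤ 1≤N 1≤N) N+N≤n)

  k≤m : k ≤ m
  k≤m = ≤-trans k≤N (m≤m*n N N {{>-nonZero 1≤N}})

  k≤N*k : k ≤ N * k
  k≤N*k = m≤n*m k N {{>-nonZero 1≤N}}

  N≡r+k : N ≡ r + k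
  N≡r+k = sym (m∸n+n≡m k≤N)

  m≡N*r+N*k : m ≡ N * r + N * k
  m≡N*r+N*k = trans (cong (N *_) N≡r+k) (*-distribˡ-+ N r k)

  m∸k≡N*r+[N*k∸k] : m ∸ k ≡ N * r + (N * k ∸ k)
  m∸k≡N*r+[N*k∸k] = trans (cong (_∸ k) m≡N*r+N*k) (+-∸-assoc (N * r) k≤N*k)

  nP′N≡nP′r*[n∸r]P′k : n P′ N ≡ (n P′ r) * ((n ∸ r) P′ k)
  nP′N≡nP′r*[n∸r]P′k = trans (cong (n P′_) N≡r+k) (nP′[r+s]≡nP′r*[n∸r]P′s n r k)

  hyperNum hyperDen binomNum binomDen : ℕ
  hyperNum = (N C k) * (a C r)
  hyperDen = n C N
  binomNum = (m C k) * (n ∸ 1) ^ (m ∸ k)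
  binomDen = n ^ m

  hyperDen>0 : 0 < hyperDen
  hyperDen>0 = nCk>0 N≤n

  binomNum>0 : 0 < binomNum
  binomNum>0 = *-mono-< (nCk>0 k≤m) (m^n>0 (n ∸ 1) {{>-nonZero 1≤n∸1}} (m ∸ k))

  binomDen>0 : 0 < binomDen
  binomDen>0 = m^n>0 n {{>-nonZero 1≤n}} m

  A B : ℕ
  A = ((N P′ k) * (N P′ k)) * ((a P′ r) * n ^ m)
  B = (m P′ k) * ((n ∸ 1) ^ (m ∸ k) * (n P′ N))

  B>0 : 0 < B
  B>0 = *-mono-< (nP′r>0 k≤m) (*-mono-< (m^n>0 (n ∸ 1) {{>-nonZero 1≤n∸1}} (m ∸ k)) (nP′r>0 N≤n))

  hyperNum*binomDen*B≡hyperDen*binomNum*A : hyperNum * binomDen * B ≡ hyperDen * binomNum * A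
  hyperNum*binomDen*B≡hyperDen*binomNum*A = begin
    (N C k) * (a C r) * n ^ m * ((m P′ k) * ((n ∸ 1) ^ (m ∸ k) * (n P′ N)))
      ≡⟨ cong₂ (λ x y → (N C k) * (a C r) * n ^ m * (x * ((n ∸ 1) ^ (m ∸ k) * y))) (sym (nCk*k!≡nP′k k≤m)) nP′N≡ ⟩
    (N C k) * (a C r) * n ^ m * ((m C k) * k ! * ((n ∸ 1) ^ (m ∸ k) * ((n C N) * ((N C k) * k ! * r !))))
      ≡⟨ regroup (N C k) (a C r) (n ^ m) (m C k) (k !) ((n ∸ 1) ^ (m ∸ k)) (n C N) (r !) ⟩
    (n C N) * ((m C k) * (n ∸ 1) ^ (m ∸ k)) * (((N C k) * k !) * ((N C k) * k !) * ((a C r) * r ! * n ^ m))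
      ≡⟨ cong₂ (λ x y → (n C N) * ((m C k) * (n ∸ 1) ^ (m ∸ k)) * (x * x * (y * n ^ m)))
           (nCk*k!≡nP′k k≤N) (nCk*k!≡nP′k r≤a) ⟩
    (n C N) * ((m C k) * (n ∸ 1) ^ (m ∸ k)) * (((N P′ k) * (N P′ k)) * ((a P′ r) * n ^ m)) ∎
    where
    open ≡-Reasoning
    r≤a : r ≤ a
    r≤a = ≤-trans (m∸n≤m N k) N≤a
    nP′N≡ : n P′ N ≡ (n C N) * ((N C k) * k ! * r !)
    nP′N≡ = begin
      n P′ N                                ≡⟨ nCk*k!≡nP′k N≤n ⟨
      (n C N) * N !                         ≡⟨ cong ((n C N) *_) (nP′n≡n! N) ⟨
      (n C N) * (N P′ N)                    ≡⟨ cong (λ x → (n C N) * (N P′ x)) (trans N≡r+k (+-comm r k)) ⟩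
      (n C N) * (N P′ (k + r))              ≡⟨ cong ((n C N) *_) (nP′[r+s]≡nP′r*[n∸r]P′s N k r) ⟩
      (n C N) * ((N P′ k) * ((N ∸ k) P′ r)) ≡⟨ cong₂ (λ x y → (n C N) * (x * y)) (sym (nCk*k!≡nP′k k≤N)) (nP′n≡n! r) ⟩
      (n C N) * ((N C k) * k ! * r !)       ∎
    regroup : ∀ c₁ c₂ d c₃ f g c₄ h → c₁ * c₂ * d * (c₃ * f * (g * (c₄ * (c₁ * f * h))))
                ≡ c₄ * (c₃ * g) * ((c₁ * f) * (c₁ * f) * (c₂ * h * d))
    regroup = solve-∀
  Q : ℕ
  Q = (n ∸ 1) ^ (N * k ∸ k) * a ^ k

  Q>0 : 0 < Q
  Q>0 = *-mono-< (m^n>0 (n ∸ 1) {{>-nonZero 1≤n∸1}} (N * k ∸ k)) (m^n>0 a {{>-nonZero 1≤a}} k)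

  Q≳n^[N*k] : Q ≳⟨ N * k + N * k / n ⟩ n ^ (N * k)
  Q≳n^[N*k] = ≳-weaken [N*k∸k]*1+k*N≤N*k+N*k (subst (λ X → Q ≳⟨ (N * k ∸ k) * 1 + k * N / n ⟩ X) n^[N*k∸k]*n^k≡n^[N*k]
    (≳-* (^-monoˡ-≤ (N * k ∸ k) (m∸n≤m n 1))
         (≳-^ (m∸n≤m n 1) (≳-∸ 1≤n) (N * k ∸ k))
         (≳-^ (m∸n≤m n N) (≳-∸ N≤n) k)))
    where
    n^[N*k∸k]*n^k≡n^[N*k] : n ^ (N * k ∸ k) * n ^ k ≡ n ^ (N * k)
    n^[N*k∸k]*n^k≡n^[N*k] = trans (sym (^-distribˡ-+-* n (N * k ∸ k) k)) (cong (n ^_) (m∸n+n≡m k≤N*k))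
    [N*k∸k]*1+k*N≤N*k+N*k : (N * k ∸ k) * 1 + k * N ≤ N * k + N * k
    [N*k∸k]*1+k*N≤N*k+N*k = +-mono-≤ (≤-trans (≤-reflexive (*-identityʳ _)) (m∸n≤m (N * k) k)) (≤-reflexive (*-comm k N))

  a^k≤[n∸r]P′k : a ^ k ≤ (n ∸ r) P′ k
  a^k≤[n∸r]P′k = c+r≤n⇒c^r≤nP′r k (≤-reflexive (begin
    n ∸ N + k       ≡⟨ cong (λ x → n ∸ x + k) N≡r+k ⟩
    n ∸ (r + k) + k ≡⟨ cong (_+ k) (∸-+-assoc n r k) ⟨
    n ∸ r ∸ k + k   ≡⟨ m∸n+n≡m k≤n∸r ⟩
    n ∸ r           ∎))
    where
    open ≡-Reasoning
    k≤n∸r : k ≤ n ∸ r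
    k≤n∸r = subst (_≤ n ∸ r) (m+n∸m≡n r k) (∸-monoˡ-≤ r (subst (_≤ n) N≡r+k N≤n))

  aP′r*n^m*Q≤[n∸1]^[m∸k]*nP′N*n^[N*k] : (a P′ r) * n ^ m * Q ≤ (n ∸ 1) ^ (m ∸ k) * (n P′ N) * n ^ (N * k)
  aP′r*n^m*Q≤[n∸1]^[m∸k]*nP′N*n^[N*k] = begin
    (a P′ r) * n ^ m * ((n ∸ 1) ^ (N * k ∸ k) * a ^ k)
      ≡⟨ cong (λ x → (a P′ r) * x * ((n ∸ 1) ^ (N * k ∸ k) * a ^ k))
           (trans (cong (n ^_) m≡N*r+N*k) (^-distribˡ-+-* n (N * r) (N * k))) ⟩
    (a P′ r) * (n ^ (N * r) * n ^ (N * k)) * ((n ∸ 1) ^ (N * k ∸ k) * a ^ k)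
      ≡⟨ regroup (a P′ r) (n ^ (N * r)) (n ^ (N * k)) ((n ∸ 1) ^ (N * k ∸ k)) (a ^ k) ⟩
    (a P′ r) * n ^ (N * r) * a ^ k * ((n ∸ 1) ^ (N * k ∸ k) * n ^ (N * k))
      ≤⟨ *-monoˡ-≤ _ (*-mono-≤ ([n∸N]P′r*n^[N*r]≤[n∸1]^[N*r]*nP′r {N = N} r 1≤n) a^k≤[n∸r]P′k) ⟩
    (n ∸ 1) ^ (N * r) * (n P′ r) * ((n ∸ r) P′ k) * ((n ∸ 1) ^ (N * k ∸ k) * n ^ (N * k))
      ≡⟨ regroup′ ((n ∸ 1) ^ (N * r)) (n P′ r) ((n ∸ r) P′ k) ((n ∸ 1) ^ (N * k ∸ k)) (n ^ (N * k)) ⟩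
    (n ∸ 1) ^ (N * r) * (n ∸ 1) ^ (N * k ∸ k) * ((n P′ r) * ((n ∸ r) P′ k)) * n ^ (N * k)
      ≡⟨ cong₂ (λ x y → x * y * n ^ (N * k))
           (trans (sym (^-distribˡ-+-* (n ∸ 1) (N * r) (N * k ∸ k))) (cong ((n ∸ 1) ^_) (sym m∸k≡N*r+[N*k∸k])))
           (sym nP′N≡nP′r*[n∸r]P′k) ⟩
    (n ∸ 1) ^ (m ∸ k) * (n P′ N) * n ^ (N * k) ∎
    where
    open ≤-Reasoning
    regroup : ∀ f x y z w → f * (x * y) * (z * w) ≡ f * x * w * (z * y)
    regroup = solve-∀
    regroup′ : ∀ x f g z y → x * f * g * (z * y) ≡ x * z * (f * g) * y
    regroup′ = solve-∀

  A*Q≤B*n^[N*k] : A * Q ≤ B * n ^ (N * k)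
  A*Q≤B*n^[N*k] = begin
    (N P′ k) * (N P′ k) * ((a P′ r) * n ^ m) * Q
      ≡⟨ *-assoc ((N P′ k) * (N P′ k)) _ Q ⟩
    (N P′ k) * (N P′ k) * ((a P′ r) * n ^ m * Q)
      ≤⟨ *-mono-≤ ([nP′r]²≤[n*n]P′r k k≤N) aP′r*n^m*Q≤[n∸1]^[m∸k]*nP′N*n^[N*k] ⟩
    (m P′ k) * ((n ∸ 1) ^ (m ∸ k) * (n P′ N) * n ^ (N * k))
      ≡⟨ *-assoc (m P′ k) _ _ ⟨
    B * n ^ (N * k) ∎
    where open ≤-Reasoning

  M*A≤M*B+B : ∀ M → suc M * (N * k + N * k) ≤ n → M * A ≤ M * B + B
  M*A≤M*B+B M h = *-cancelʳ-≤ (M * A) (M * B + B) Q {{>-nonZero Q>0}} (begin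
    M * A * Q               ≡⟨ *-assoc M A Q ⟩
    M * (A * Q)             ≤⟨ *-monoʳ-≤ M A*Q≤B*n^[N*k] ⟩
    M * (B * n ^ (N * k))   ≡⟨ x∙yz≈y∙xz M B _ ⟩
    B * (M * n ^ (N * k))   ≤⟨ *-monoʳ-≤ B (≳⇒M*X≤[1+M]*x M 1≤n h Q≳n^[N*k]) ⟩
    B * (suc M * Q)         ≡⟨ expand M B Q ⟩
    (M * B + B) * Q         ∎)
    where
    open ≤-Reasoning
    expand : ∀ M B Q → B * (suc M * Q) ≡ (M * B + B) * Q
    expand = solve-∀

  -- (g / G)ʳ bounds the ratio of the second factors of A and B from below
  G g : ℕ
  G = a * (n ∸ 1)
  g = (n ∸ (N + N)) * ((n ∸ 1) + N)

  g+2N²≡G+N : g + (N * N + N * N) ≡ G + N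
  g+2N²≡G+N = [n∸2N]*[n∸1+N]+2N²≡[n∸N]*[n∸1]+N 1≤N N+N≤n

  g≤G : g ≤ G
  g≤G = +-cancelʳ-≤ (N * N + N * N) g G (begin
    g + (N * N + N * N) ≡⟨ g+2N²≡G+N ⟩
    G + N               ≤⟨ +-monoʳ-≤ G (≤-trans (m≤m*n N N {{>-nonZero 1≤N}}) (m≤m+n (N * N) (N * N))) ⟩
    G + (N * N + N * N) ∎)
    where open ≤-Reasoning

  g≳G : g ≳⟨ N * N + N * N / G ⟩ G
  g≳G = ≳-self (≤-trans (m≤m+n G N) (≤-reflexive (sym g+2N²≡G+N)))

  G>0 : 0 < G
  G>0 = *-mono-< 1≤a 1≤n∸1

  nP′r*[n∸2N]^r≤aP′r*a^r : (n P′ r) * (n ∸ (N + N)) ^ r ≤ (a P′ r) * a ^ r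
  nP′r*[n∸2N]^r≤aP′r*a^r = subst₂ (λ x y → (x P′ r) * y ^ r ≤ (a P′ r) * a ^ r) (m∸n+n≡m N≤n) (∸-+-assoc n N N)
    ([a+n]P′r*[a∸n]^r≤aP′r*a^r r (m∸n≤m N k) N≤a)

  [n∸1]^[N*r]*[n∸1+N]^r≤n^[N*r]*[n∸1]^r : (n ∸ 1) ^ (N * r) * ((n ∸ 1) + N) ^ r ≤ n ^ (N * r) * (n ∸ 1) ^ r
  [n∸1]^[N*r]*[n∸1+N]^r≤n^[N*r]*[n∸1]^r = subst₂ _≤_
    (trans ([m*n]^o≡m^o*n^o ((n ∸ 1) ^ N) ((n ∸ 1) + N) r) (cong (_* ((n ∸ 1) + N) ^ r) (^-*-assoc (n ∸ 1) N r)))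
    (trans ([m*n]^o≡m^o*n^o (n ^ N) (n ∸ 1) r) (cong (_* (n ∸ 1) ^ r) (^-*-assoc n N r)))
    (^-monoˡ-≤ r (subst (λ x → (n ∸ 1) ^ N * ((n ∸ 1) + N) ≤ x ^ N * (n ∸ 1)) 1+[n∸1]≡n (b^N*[b+N]≤[1+b]^N*b (n ∸ 1) N)))
    where
    1+[n∸1]≡n : suc (n ∸ 1) ≡ n
    1+[n∸1]≡n = trans (+-comm 1 (n ∸ 1)) (m∸n+n≡m 1≤n)

  nP′N≤nP′r*n^k : n P′ N ≤ (n P′ r) * n ^ k
  nP′N≤nP′r*n^k = subst (_≤ (n P′ r) * n ^ k) (sym nP′N≡nP′r*[n∸r]P′k)
    (*-monoʳ-≤ (n P′ r) (≤-trans (nP′r≤n^r (n ∸ r) k) (^-monoˡ-≤ k (m∸n≤m n r))))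

  n^k*[n∸1]^[N*k∸k]≤n^[N*k] : n ^ k * (n ∸ 1) ^ (N * k ∸ k) ≤ n ^ (N * k)
  n^k*[n∸1]^[N*k∸k]≤n^[N*k] = begin
    n ^ k * (n ∸ 1) ^ (N * k ∸ k) ≤⟨ *-monoʳ-≤ (n ^ k) (^-monoˡ-≤ (N * k ∸ k) (m∸n≤m n 1)) ⟩
    n ^ k * n ^ (N * k ∸ k)       ≡⟨ ^-distribˡ-+-* n k (N * k ∸ k) ⟨
    n ^ (k + (N * k ∸ k))         ≡⟨ cong (n ^_) (m+[n∸m]≡n k≤N*k) ⟩
    n ^ (N * k)                   ∎
    where open ≤-Reasoning

  [n∸1]^[m∸k]*nP′N*g^r≤aP′r*n^m*G^r : (n ∸ 1) ^ (m ∸ k) * (n P′ N) * g ^ r ≤ (a P′ r) * n ^ m * G ^ r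
  [n∸1]^[m∸k]*nP′N*g^r≤aP′r*n^m*G^r = begin
    (n ∸ 1) ^ (m ∸ k) * (n P′ N) * g ^ r
      ≡⟨ cong₂ (λ x y → x * (n P′ N) * y)
           (trans (cong ((n ∸ 1) ^_) m∸k≡N*r+[N*k∸k]) (^-distribˡ-+-* (n ∸ 1) (N * r) (N * k ∸ k)))
           ([m*n]^o≡m^o*n^o (n ∸ (N + N)) ((n ∸ 1) + N) r) ⟩
    (n ∸ 1) ^ (N * r) * (n ∸ 1) ^ (N * k ∸ k) * (n P′ N) * ((n ∸ (N + N)) ^ r * ((n ∸ 1) + N) ^ r)
      ≤⟨ *-monoˡ-≤ _ (*-monoʳ-≤ ((n ∸ 1) ^ (N * r) * (n ∸ 1) ^ (N * k ∸ k)) nP′N≤nP′r*n^k) ⟩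
    (n ∸ 1) ^ (N * r) * (n ∸ 1) ^ (N * k ∸ k) * ((n P′ r) * n ^ k) * ((n ∸ (N + N)) ^ r * ((n ∸ 1) + N) ^ r)
      ≡⟨ regroup ((n ∸ 1) ^ (N * r)) ((n ∸ 1) ^ (N * k ∸ k)) (n P′ r) (n ^ k) ((n ∸ (N + N)) ^ r) (((n ∸ 1) + N) ^ r) ⟩
    ((n P′ r) * (n ∸ (N + N)) ^ r) * ((n ∸ 1) ^ (N * r) * ((n ∸ 1) + N) ^ r) * (n ^ k * (n ∸ 1) ^ (N * k ∸ k))
      ≤⟨ *-mono-≤ (*-mono-≤ nP′r*[n∸2N]^r≤aP′r*a^r [n∸1]^[N*r]*[n∸1+N]^r≤n^[N*r]*[n∸1]^r)
                  n^k*[n∸1]^[N*k∸k]≤n^[N*k] ⟩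
    ((a P′ r) * a ^ r) * (n ^ (N * r) * (n ∸ 1) ^ r) * n ^ (N * k)
      ≡⟨ regroup′ (a P′ r) (a ^ r) (n ^ (N * r)) ((n ∸ 1) ^ r) (n ^ (N * k)) ⟩
    (a P′ r) * (n ^ (N * r) * n ^ (N * k)) * (a ^ r * (n ∸ 1) ^ r)
      ≡⟨ cong₂ (λ x y → (a P′ r) * x * y) (trans (sym (^-distribˡ-+-* n (N * r) (N * k))) (cong (n ^_) (sym m≡N*r+N*k)))
           (sym ([m*n]^o≡m^o*n^o a (n ∸ 1) r)) ⟩
    (a P′ r) * n ^ m * G ^ r ∎
    where
    open ≤-Reasoning
    regroup : ∀ p q f x y z → p * q * (f * x) * (y * z) ≡ (f * y) * (p * z) * (x * q)
    regroup = solve-∀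
    regroup′ : ∀ f x p q z → (f * x) * (p * q) * z ≡ f * (p * z) * (x * q)
    regroup′ = solve-∀

  aP′r*n^m≳[n∸1]^[m∸k]*nP′N : (a P′ r) * n ^ m ≳⟨ r * (N * N + N * N) / G ⟩ (n ∸ 1) ^ (m ∸ k) * (n P′ N)
  aP′r*n^m≳[n∸1]^[m∸k]*nP′N =
    ≳-transfer (m^n>0 G {{>-nonZero G>0}} r) [n∸1]^[m∸k]*nP′N*g^r≤aP′r*n^m*G^r (≳-^ g≤G g≳G r)

  A≳B : A ≳⟨ k * (k + k) * G + r * (N * N + N * N) * N / N * G ⟩ B
  A≳B = ≳-* ([nP′r]²≤[n*n]P′r k k≤N) (≳-scale G ([NP′k]²≳[N*N]P′k 1≤N k≤N))
    (subst (λ D → (a P′ r) * n ^ m ≳⟨ r * (N * N + N * N) * N / D ⟩ (n ∸ 1) ^ (m ∸ k) * (n P′ N)) (*-comm G N)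
      (≳-scale N aP′r*n^m≳[n∸1]^[m∸k]*nP′N))

  n*n≤4*G : n * n ≤ 4 * G
  n*n≤4*G = begin
    n * n                         ≤⟨ *-mono-≤ n≤2a n≤2[n∸1] ⟩
    (a + a) * ((n ∸ 1) + (n ∸ 1)) ≡⟨ double² a (n ∸ 1) ⟩
    4 * G                         ∎
    where
    open ≤-Reasoning
    n≤2a : n ≤ a + a
    n≤2a = subst (_≤ a + a) (m∸n+n≡m N≤n) (+-monoʳ-≤ a N≤a)
    n≤2[n∸1] : n ≤ (n ∸ 1) + (n ∸ 1)
    n≤2[n∸1] = subst (_≤ (n ∸ 1) + (n ∸ 1)) (m∸n+n≡m 1≤n) (+-monoʳ-≤ (n ∸ 1) 1≤n∸1)
    double² : ∀ x y → (x + x) * (y + y) ≡ 4 * (x * y)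
    double² = solve-∀

  M*B≤M*A+B : ∀ M → M * (k * k) * 4 ≤ N → M * (N * N * N) * 16 ≤ n * n → M * B ≤ M * A + B
  M*B≤M*A+B M h₁ h₂ = ≳⇒M*X≤M*x+X M (*-mono-< 1≤N G>0) (*-cancelˡ-≤ 2 (begin
    2 * (M * (k * (k + k) * G + r * (N * N + N * N) * N))
      ≡⟨ expand M k G r N ⟩
    M * (k * k) * 4 * G + M * (r * N * N) * 4 * N
      ≤⟨ +-mono-≤ (*-monoˡ-≤ G h₁) (*-monoˡ-≤ N (≤-trans 4MrN²≤4MN³ 4MN³≤G)) ⟩
    N * G + G * N
      ≡⟨ cong (N * G +_) (*-comm G N) ⟩
    N * G + N * G
      ≡⟨ cong (N * G +_) (+-identityʳ (N * G)) ⟨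
    2 * (N * G)   ∎)) A≳B
    where
    open ≤-Reasoning
    4MrN²≤4MN³ : M * (r * N * N) * 4 ≤ M * (N * N * N) * 4
    4MrN²≤4MN³ = *-monoˡ-≤ 4 (*-monoʳ-≤ M (*-monoˡ-≤ N (*-monoˡ-≤ N (m∸n≤m N k))))
    4MN³≤G : M * (N * N * N) * 4 ≤ G
    4MN³≤G = *-cancelˡ-≤ 4 (≤-trans (≤-reflexive (4*[M*x*4]≡M*x*16 M (N * N * N))) (≤-trans h₂ n*n≤4*G))
      where
      4*[M*x*4]≡M*x*16 : ∀ M x → 4 * (M * x * 4) ≡ M * x * 16
      4*[M*x*4]≡M*x*16 = solve-∀
    expand : ∀ M k G r N → 2 * (M * (k * (k + k) * G + r * (N * N + N * N) * N)) ≡ M * (k * k) * 4 * G + M * (r * N * N) * 4 * N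
    expand = solve-∀

  relative-error≤1/M : ∀ M → suc M * (N * k + N * k) ≤ n → M * (k * k) * 4 ≤ N → M * (N * N * N) * 16 ≤ n * n →
    M * ℕ.∣ hyperNum * binomDen - hyperDen * binomNum ∣ ≤ hyperDen * binomNum
  relative-error≤1/M M h h₁ h₂ = x*t≡y*s⇒M*∣x-y∣≤y M {x = hyperNum * binomDen} B>0
    hyperNum*binomDen*B≡hyperDen*binomNum*A (M*∣a-b∣≤b M (M*A≤M*B+B M h) (M*B≤M*A+B M h₁ h₂))


-- Size bounds

1≤n∧n^7<[1+N]^12⇒1≤N : ∀ {n N} → 1 ≤ n → n ^ 7 < suc N ^ 12 → 1 ≤ N
1≤n∧n^7<[1+N]^12⇒1≤N {N = zero}  1≤n n^7<1 =
  contradiction (≤-trans (≤-reflexive (sym (^-zeroˡ 7))) (^-monoˡ-≤ 7 1≤n)) (<⇒≱ n^7<1)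
1≤n∧n^7<[1+N]^12⇒1≤N {N = suc _} _   _    = s≤s z≤n

module SizeBounds {c n N k : ℕ} (2≤c : 2 ≤ c) (c^20≤n : c ^ 20 ≤ n)
               (N^12≤n^7 : N ^ 12 ≤ n ^ 7) (n^7<[1+N]^12 : n ^ 7 < suc N ^ 12) (k^5≤n : k ^ 5 ≤ n) where

  1≤c : 1 ≤ c
  1≤c = ≤-trans (s≤s z≤n) 2≤c

  1≤n : 1 ≤ n
  1≤n = ≤-trans (≤-trans (≤-reflexive (sym (^-zeroˡ 20))) (^-monoˡ-≤ 20 1≤c)) c^20≤n

  instance
    n≢0 : NonZero n
    n≢0 = >-nonZero 1≤n

  c^60≤n^3 : c ^ 60 ≤ n ^ 3
  c^60≤n^3 = ≤-trans (≤-reflexive (sym (^-*-assoc c 20 3))) (^-monoˡ-≤ 3 c^20≤n)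

  c^12≤n^3 : c ^ 12 ≤ n ^ 3
  c^12≤n^3 = ≤-trans (^-monoʳ-≤ c {{>-nonZero 1≤c}} (m≤m+n 12 48)) c^60≤n^3

  k^60≤n^12 : k ^ 60 ≤ n ^ 12
  k^60≤n^12 = subst (_≤ n ^ 12) (^-*-assoc k 5 12) (^-monoˡ-≤ 12 k^5≤n)

  1≤N : 1 ≤ N
  1≤N = 1≤n∧n^7<[1+N]^12⇒1≤N 1≤n n^7<[1+N]^12

  N+N≤n : N + N ≤ n
  N+N≤n = ^-cancelˡ-≤ 12 (begin
    (N + N) ^ 12        ≡⟨ cong (_^ 12) (cong (N +_) (sym (+-identityʳ N))) ⟩
    (2 * N) ^ 12        ≡⟨ [m*n]^o≡m^o*n^o 2 N 12 ⟩
    2 ^ 12 * N ^ 12     ≤⟨ *-mono-≤ 2^12≤n^5 N^12≤n^7 ⟩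
    n ^ 5 * n ^ 7       ≡⟨ ^-distribˡ-+-* n 5 7 ⟨
    n ^ 12              ∎)
    where
    open ≤-Reasoning
    2^12≤n^5 : 2 ^ 12 ≤ n ^ 5
    2^12≤n^5 = ≤-trans (^-monoˡ-≤ 12 2≤c) (≤-trans c^12≤n^3 (^-monoʳ-≤ n (m≤m+n 3 2)))

  c*N*k≤n : c * N * k ≤ n
  c*N*k≤n = ^-cancelˡ-≤ 60 (begin
    (c * N * k) ^ 60                   ≡⟨ [x*y*z]^e≡x^e*y^e*z^e c N k 60 ⟩
    c ^ 60 * N ^ 60 * k ^ 60           ≡⟨ cong (λ x → c ^ 60 * x * k ^ 60) (^-*-assoc N 12 5) ⟨
    c ^ 60 * (N ^ 12) ^ 5 * k ^ 60     ≤⟨ *-mono-≤ (*-mono-≤ c^60≤n^3 (^-monoˡ-≤ 5 N^12≤n^7)) k^60≤n^12 ⟩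
    n ^ 3 * (n ^ 7) ^ 5 * n ^ 12       ≡⟨ cong (λ x → n ^ 3 * x * n ^ 12) (^-*-assoc n 7 5) ⟩
    n ^ 3 * n ^ 35 * n ^ 12            ≡⟨ cong (_* n ^ 12) (^-distribˡ-+-* n 3 35) ⟨
    n ^ 38 * n ^ 12                    ≡⟨ ^-distribˡ-+-* n 38 12 ⟨
    n ^ 50                             ≤⟨ ^-monoʳ-≤ n (m≤m+n 50 10) ⟩
    n ^ 60                             ∎)
    where open ≤-Reasoning

  c*[k*k]≤N : c * (k * k) ≤ N
  c*[k*k]≤N = ℕ.s≤s⁻¹ (^-cancelˡ-< 60 {c * (k * k)} {suc N} (begin-strict
    (c * (k * k)) ^ 60             ≡⟨ cong (_^ 60) (*-assoc c k k) ⟨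
    (c * k * k) ^ 60               ≡⟨ [x*y*z]^e≡x^e*y^e*z^e c k k 60 ⟩
    c ^ 60 * k ^ 60 * k ^ 60       ≤⟨ *-mono-≤ (*-mono-≤ c^60≤n^3 k^60≤n^12) k^60≤n^12 ⟩
    n ^ 3 * n ^ 12 * n ^ 12        ≡⟨ cong (_* n ^ 12) (^-distribˡ-+-* n 3 12) ⟨
    n ^ 15 * n ^ 12                ≡⟨ ^-distribˡ-+-* n 15 12 ⟨
    n ^ 27                         ≤⟨ ^-monoʳ-≤ n (m≤m+n 27 8) ⟩
    n ^ 35                         ≡⟨ ^-*-assoc n 7 5 ⟨
    (n ^ 7) ^ 5                    <⟨ ^-monoˡ-< 5 n^7<[1+N]^12 ⟩
    (suc N ^ 12) ^ 5               ≡⟨ [x^12]^5≡x^60 (suc N) ⟩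
    suc N ^ 60                     ∎))
    where
    open ≤-Reasoning
    -- Kept abstract in x (and suc N passed explicitly above): unifying with
    -- suc N ^ 60 directly makes Agda normalise the 60th power of suc N.
    [x^12]^5≡x^60 : ∀ x → (x ^ 12) ^ 5 ≡ x ^ 60
    [x^12]^5≡x^60 x = ^-*-assoc x 12 5

  c*[N*N*N]≤n*n : c * (N * N * N) ≤ n * n
  c*[N*N*N]≤n*n = ^-cancelˡ-≤ 12 (begin
    (c * (N * N * N)) ^ 12               ≡⟨ [m*n]^o≡m^o*n^o c (N * N * N) 12 ⟩
    c ^ 12 * (N * N * N) ^ 12            ≡⟨ cong (c ^ 12 *_) ([x*y*z]^e≡x^e*y^e*z^e N N N 12) ⟩
    c ^ 12 * (N ^ 12 * N ^ 12 * N ^ 12)  ≤⟨ *-mono-≤ c^12≤n^3 (*-mono-≤ (*-mono-≤ N^12≤n^7 N^12≤n^7) N^12≤n^7) ⟩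
    n ^ 3 * (n ^ 7 * n ^ 7 * n ^ 7)      ≡⟨ cong (λ x → n ^ 3 * (x * n ^ 7)) (^-distribˡ-+-* n 7 7) ⟨
    n ^ 3 * (n ^ 14 * n ^ 7)             ≡⟨ cong (n ^ 3 *_) (^-distribˡ-+-* n 14 7) ⟨
    n ^ 3 * n ^ 21                       ≡⟨ ^-distribˡ-+-* n 3 21 ⟨
    n ^ 24                               ≡⟨ ^-distribˡ-+-* n 12 12 ⟩
    n ^ 12 * n ^ 12                      ≡⟨ [m*n]^o≡m^o*n^o n n 12 ⟨
    (n * n) ^ 12                         ∎)
    where open ≤-Reasoning

  k≤N : k ≤ N
  k≤N = ≤-trans (k≤c*[k*k] k) c*[k*k]≤N
    where
    k≤c*[k*k] : ∀ k → k ≤ c * (k * k)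
    k≤c*[k*k] zero    = z≤n
    k≤c*[k*k] (suc k) = ≤-trans (m≤m*n (suc k) (suc k)) (m≤n*m (suc k * suc k) c {{>-nonZero 1≤c}})


-- Rational arithmetic

toℚᵘ-divℕ : ∀ a b → toℚᵘ (divℕ a (suc b)) ℚᵘ.≃ mkℚᵘ (ℤ.+ a) b
toℚᵘ-divℕ a b = ℚ.toℚᵘ-fromℚᵘ (mkℚᵘ (ℤ.+ a) b)

divℕ-cong : ∀ {a b c d} → 0 < b → 0 < d → a * d ≡ c * b → divℕ a b ≡ divℕ c d
divℕ-cong {a} {suc b} {c} {suc d} _ _ ad≡cb = ℚ.toℚᵘ-injective
  (ℚᵘ.≃-trans (toℚᵘ-divℕ a b) (ℚᵘ.≃-trans (*≡* cross) (ℚᵘ.≃-sym (toℚᵘ-divℕ c d))))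
  where
  cross : ℤ.+ a ℤ.* ℤ.+ suc d ≡ ℤ.+ c ℤ.* ℤ.+ suc b
  cross = trans (sym (ℤ.pos-* a (suc d))) (trans (cong ℤ.+_ ad≡cb) (ℤ.pos-* c (suc b)))

divℕ-mono-≤ : ∀ {a b c d} → 0 < b → 0 < d → a * d ≤ c * b → divℕ a b ℚ.≤ divℕ c d
divℕ-mono-≤ {a} {suc b} {c} {suc d} _ _ ad≤cb = ℚ.toℚᵘ-cancel-≤
  (ℚᵘ.≤-respˡ-≃ (ℚᵘ.≃-sym (toℚᵘ-divℕ a b)) (ℚᵘ.≤-respʳ-≃ (ℚᵘ.≃-sym (toℚᵘ-divℕ c d)) (*≤* cross)))
  where
  cross : ℤ.+ a ℤ.* ℤ.+ suc d ℤ.≤ ℤ.+ c ℤ.* ℤ.+ suc b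
  cross = subst₂ ℤ._≤_ (ℤ.pos-* a (suc d)) (ℤ.pos-* c (suc b)) (ℤ.+≤+ ad≤cb)

divℕ-*-divℕ : ∀ {a b c d} → 0 < b → 0 < d → divℕ a b ℚ.* divℕ c d ≡ divℕ (a * c) (b * d)
divℕ-*-divℕ {a} {suc b} {c} {suc d} _ _ = ℚ.toℚᵘ-injective
  (ℚᵘ.≃-trans (ℚ.toℚᵘ-homo-* (divℕ a (suc b)) (divℕ c (suc d)))
  (ℚᵘ.≃-trans (ℚᵘ.*-cong (toℚᵘ-divℕ a b) (toℚᵘ-divℕ c d))
  (ℚᵘ.≃-trans (*≡* (cong (ℤ._* +[1+ d + b * suc d ]) (sym (ℤ.pos-* a c))))
  (ℚᵘ.≃-sym (toℚᵘ-divℕ (a * c) _)))))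

divℕ-≢0 : ∀ {a b} → 0 < a → 0 < b → divℕ a b ≢ 0ℚ
divℕ-≢0 {suc a} {suc b} _ _ eq with ℚᵘ.≃-trans (ℚᵘ.≃-sym (toℚᵘ-divℕ (suc a) b)) (ℚ.toℚᵘ-cong eq)
... | *≡* ()

∣m⊖n∣≡∣m-n∣ : ∀ m n → ℤ.∣ m ⊖ n ∣ ≡ ℕ.∣ m - n ∣
∣m⊖n∣≡∣m-n∣ m n with ≤-total m n
... | inj₁ m≤n = trans (ℤ.∣⊖∣-≤ m≤n) (sym (m≤n⇒∣m-n∣≡n∸m m≤n))
... | inj₂ n≤m = trans (cong ℤ.∣_∣ (ℤ.⊖-≥ n≤m)) (sym (m≤n⇒∣n-m∣≡n∸m n≤m))

∣divℕ-1∣≡divℕ∣-∣ : ∀ {a b} → 0 < b → ∣ divℕ a b - 1ℚ ∣ ≡ divℕ ℕ.∣ a - b ∣ b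
∣divℕ-1∣≡divℕ∣-∣ {a} {suc b} _ = ℚ.toℚᵘ-injective
  (ℚᵘ.≃-trans (ℚ.toℚᵘ-homo-∣-∣ (divℕ a (suc b) - 1ℚ))
  (ℚᵘ.≃-trans (ℚᵘ.∣-∣-cong
    (ℚᵘ.≃-trans (ℚ.toℚᵘ-homo-+ (divℕ a (suc b)) (ℚ.- 1ℚ)) (ℚᵘ.+-congˡ _ (toℚᵘ-divℕ a b))))
  (ℚᵘ.≃-trans (*≡* (cong₂ (λ u v → ℤ.+ u ℤ.* +[1+ v ]) ∣numerator∣ (sym (*-identityʳ b))))
  (ℚᵘ.≃-sym (toℚᵘ-divℕ ℕ.∣ a - suc b ∣ b)))))
  where
  ∣numerator∣ : ℤ.∣ ℤ.+ a ℤ.* ℤ.+ 1 ℤ.+ -[1+ 0 ] ℤ.* +[1+ b ] ∣ ≡ ℕ.∣ a - suc b ∣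
  ∣numerator∣ = trans
    (cong ℤ.∣_∣ (trans (cong₂ ℤ._+_ (ℤ.*-identityʳ (ℤ.+ a)) (ℤ.-1*i≡-i +[1+ b ])) (ℤ.m-n≡m⊖n a (suc b))))
    (∣m⊖n∣≡∣m-n∣ a (suc b))

ratio-unique : ∀ {p q r} → q ≢ 0ℚ → r ℚ.* q ≡ p → ratio p q ≡ r
ratio-unique {p} {q} {r} q≢0 rq≡p with q ℚ.≟ 0ℚ
... | yes q≡0 = contradiction q≡0 q≢0
... | no q≢0′ = begin
  p ℚ.* ℚ.1/ q         ≡⟨ cong (ℚ._* ℚ.1/ q) rq≡p ⟨
  r ℚ.* q ℚ.* ℚ.1/ q   ≡⟨ ℚ.*-assoc r q (ℚ.1/ q) ⟩
  r ℚ.* (q ℚ.* ℚ.1/ q) ≡⟨ cong (r ℚ.*_) (ℚ.*-inverseʳ q) ⟩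
  r ℚ.* 1ℚ             ≡⟨ ℚ.*-identityʳ r ⟩
  r                    ∎
  where
  open ≡-Reasoning
  instance _ = ℚ.≢-nonZero q≢0′

ratio-divℕ : ∀ {a b c d} → 0 < b → 0 < c → 0 < d → ratio (divℕ a b) (divℕ c d) ≡ divℕ (a * d) (b * c)
ratio-divℕ {a} {b} {c} {d} b>0 c>0 d>0 = ratio-unique (divℕ-≢0 c>0 d>0) (begin
  divℕ (a * d) (b * c) ℚ.* divℕ c d ≡⟨ divℕ-*-divℕ bc>0 d>0 ⟩
  divℕ (a * d * c) (b * c * d)      ≡⟨ divℕ-cong (*-mono-< bc>0 d>0) b>0 (regroup a b c d) ⟩
  divℕ a b                          ∎)
  where
  open ≡-Reasoning
  bc>0 : 0 < b * c
  bc>0 = *-mono-< b>0 c>0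
  regroup : ∀ a b c d → a * d * c * b ≡ a * (b * c * d)
  regroup = solve-∀

∣ratio-divℕ-1∣≤1/M : ∀ M {a b c d} → 0 < M → 0 < b → 0 < c → 0 < d → M * ℕ.∣ a * d - b * c ∣ ≤ b * c →
  ∣ ratio (divℕ a b) (divℕ c d) - 1ℚ ∣ ℚ.≤ divℕ 1 M
∣ratio-divℕ-1∣≤1/M M {a} {b} {c} {d} M>0 b>0 c>0 d>0 M∣ad-bc∣≤bc = begin
  ∣ ratio (divℕ a b) (divℕ c d) - 1ℚ ∣ ≡⟨ cong (λ x → ∣ x - 1ℚ ∣) (ratio-divℕ b>0 c>0 d>0) ⟩
  ∣ divℕ (a * d) (b * c) - 1ℚ ∣        ≡⟨ ∣divℕ-1∣≡divℕ∣-∣ (*-mono-< b>0 c>0) ⟩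
  divℕ ℕ.∣ a * d - b * c ∣ (b * c)     ≤⟨ divℕ-mono-≤ (*-mono-< b>0 c>0) M>0
                                            (subst₂ _≤_ (*-comm M _) (sym (*-identityˡ (b * c))) M∣ad-bc∣≤bc) ⟩
  divℕ 1 M                             ∎
  where open ℚ.≤-Reasoning

0<ε⇒∃1/[1+M]≤ε : ∀ {ε} → 0ℚ ℚ.< ε → ∃ λ M → divℕ 1 (suc M) ℚ.≤ ε
0<ε⇒∃1/[1+M]≤ε {ε@(mkℚ +[1+ p ] q _)} _ = q , subst (divℕ 1 (suc q) ℚ.≤_) (ℚ.↥p/↧p≡p ε)
  (divℕ-mono-≤ {1} {suc q} {suc p} {suc q} (s≤s z≤n) (s≤s z≤n) (*-monoˡ-≤ (suc q) {1} {suc p} (s≤s z≤n)))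
0<ε⇒∃1/[1+M]≤ε {mkℚ (ℤ.+ 0)   _ _} (ℚ.*<* (ℤ.+<+ ()))
0<ε⇒∃1/[1+M]≤ε {mkℚ -[1+ _ ] _ _} (ℚ.*<* ())

hyperGeomPMF-≤ : ∀ {n B A k} → k ≤ B → hyperGeomPMF n B A k ≡ divℕ ((A C k) * ((n ∸ A) C (B ∸ k))) (n C B)
hyperGeomPMF-≤ {B = B} {k = k} k≤B with k ≤? B
... | yes _  = refl
... | no k≰B = contradiction k≤B k≰B

∣ratio-hyperGeom-binomial-1∣≤1/M : ∀ {M c n N k} → 0 < M → 16 * suc M ≤ c → c ^ 20 ≤ n →
  N ^ 12 ≤ n ^ 7 → n ^ 7 < suc N ^ 12 → k ^ 5 ≤ n →
  ∣ ratio (hyperGeomPMF n N N k) (binomialInvPMF (N * N) n k) - 1ℚ ∣ ℚ.≤ divℕ 1 M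
∣ratio-hyperGeom-binomial-1∣≤1/M {M} {c} {n} {N} {k} M>0 16[1+M]≤c c^20≤n N^12≤n^7 n^7<[1+N]^12 k^5≤n =
  subst (λ x → ∣ ratio x (binomialInvPMF (N * N) n k) - 1ℚ ∣ ℚ.≤ divℕ 1 M) (sym (hyperGeomPMF-≤ k≤N))
    (∣ratio-divℕ-1∣≤1/M M M>0 hyperDen>0 binomNum>0 binomDen>0 (relative-error≤1/M M
      (≤-trans (≤-reflexive ([1+M]*[x+x]≡2*[1+M]*x M (N * k)))
        (≤-trans (*-monoˡ-≤ (N * k) (≤c (*-monoˡ-≤ (suc M) (m≤m+n 2 14))))
        (≤-trans (≤-reflexive (sym (*-assoc c N k))) c*N*k≤n)))
      (≤-trans (≤-reflexive (M*x*a≡a*M*x 4 M (k * k)))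
        (≤-trans (*-monoˡ-≤ (k * k) (≤c (*-mono-≤ (m≤m+n 4 12) (n≤1+n M)))) c*[k*k]≤N))
      (≤-trans (≤-reflexive (M*x*a≡a*M*x 16 M (N * N * N)))
        (≤-trans (*-monoˡ-≤ (N * N * N) (≤c (*-monoʳ-≤ 16 (n≤1+n M)))) c*[N*N*N]≤n*n))))
  where
  ≤c : ∀ {x} → x ≤ 16 * suc M → x ≤ c
  ≤c x≤16[1+M] = ≤-trans x≤16[1+M] 16[1+M]≤c
  open SizeBounds {c} {n} {N} {k} (≤c (≤-trans (m≤m*n 2 (suc M)) (*-monoˡ-≤ (suc M) (m≤m+n 2 14))))
    c^20≤n N^12≤n^7 n^7<[1+N]^12 k^5≤n
  open HyperGeomVsBinomial 1≤N k≤N N+N≤n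
  [1+M]*[x+x]≡2*[1+M]*x : ∀ M x → suc M * (x + x) ≡ 2 * suc M * x
  [1+M]*[x+x]≡2*[1+M]*x = solve-∀
  M*x*a≡a*M*x : ∀ a M x → M * x * a ≡ a * M * x
  M*x*a≡a*M*x = solve-∀

lemma3p5 : (ε : ℚ) → 0ℚ ℚ.< ε →
    ∃ λ n₀ → (n N : ℕ) → n₀ ≤ n →
      N ^ 12 ≤ n ^ 7 → n ^ 7 < suc N ^ 12 →
      (k : ℕ) → k ^ 5 ≤ n →
      ∣ ratio (hyperGeomPMF n N N k) (binomialInvPMF (N ℕ.* N) n k) - 1ℚ ∣ ℚ.≤ ε
lemma3p5 ε 0<ε with 0<ε⇒∃1/[1+M]≤ε 0<ε
... | M , 1/[1+M]≤ε = (16 * suc (suc M)) ^ 20 , λ n N n₀≤n N^12≤n^7 n^7<[1+N]^12 k k^5≤n →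
  -- implicit arguments cannot be inferred through _^_, and trying to for c unfolds (16 (M + 2))²⁰
  ℚ.≤-trans (∣ratio-hyperGeom-binomial-1∣≤1/M {suc M} {16 * suc (suc M)} {n} {N} {k}
              (s≤s z≤n) ≤-refl n₀≤n N^12≤n^7 n^7<[1+N]^12 k^5≤n)
            1/[1+M]≤ε
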